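{- Let $d$ and $\delta$ be positive integers with $d>\delta>0$. Then the sequence $\left\{\binom{id}{i\delta}\right\}_{i\ge 0}$ is log-convex, i.e., $\binom{(i+1)d}{(i+1)\delta}\binom{(i-1)d}{(i-1)\delta}\ge\binom{id}{i\delta}^2$ for all $i\ge1$.
   Context: A sequence $a_0,a_1,\ldots$ is log-convex if $a_{i-1}a_{i+1}\ge a_i^2$ for all $i\ge1$. -}

module Defs where

module Submission where

-- Write d = δ + e with e > 0 and let  rise c k = (c+1)(c+2)⋯(c+k).  Since
-- (c+k)! = c! · rise c k, the factorial formula for binomials gives the ratio
-- identity
--     a (m+1) · P m = a m · D m,   D m = rise (m d) d,  P m = rise (m δ) δ · rise (m e) e.
-- A sequence whose consecutive ratios D m / P m increase is log-convex
-- (ratios-increasing⇒log-convex), so it suffices to prove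
--     D n · P (n+1) ≤ D (n+1) · P n.                                  (ratio-monotone)
-- Both sides are products of 2d linear factors.  The k-th factor of D n is
-- paired with the b-th factor of the δ- or of the e-product, and each pair obeys
--     (n d + k)((n+1) y + b) ≤ ((n+1) d + k)(n y + b)   whenever k y ≤ d b
-- (factor-inequality).  Choosing the partner by merging the fractions b/δ and
-- b/e in increasing order keeps the condition true (the Balanced invariant of the
-- module Merge); after d merge steps balance forces exactly δ factors of the
-- δ-product and e factors of the e-product to have been used.

open import Defs
open import Data.Nat using (ℕ; _*_; _∸_; _≤_; _<_; _+_; suc)
open import Data.Nat.Combinatorics using (_C_; k![n∸k]!∣n!)
open import Data.Nat.Base using (zero; _!; z≤n; NonZero)
open import Data.Nat.Properties
open import Data.Nat.Combinatorics.Specification using (nCk≡n!/k![n-k]!)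
open import Data.Nat.DivMod using (m/n*n≡m)
open import Data.Nat.Solver using (module +-*-Solver)
open import Data.Product using (Σ; _×_; _,_)
open import Relation.Binary.PropositionalEquality
open import Relation.Nullary using (yes; no)
open +-*-Solver

rise : ℕ → ℕ → ℕ
rise c zero    = 1
rise c (suc k) = rise c k * (c + suc k)

rise-nonZero : ∀ c k → NonZero (rise c k)
rise-nonZero c zero    = _
rise-nonZero c (suc k) =
  m*n≢0 (rise c k) (c + suc k) {{rise-nonZero c k}} {{subst NonZero (sym (+-suc c k)) _}}

factorial-rise : ∀ c k → c ! * rise c k ≡ (c + k) !
factorial-rise c zero    = trans (*-identityʳ (c !)) (cong _! (sym (+-identityʳ c)))
factorial-rise c (suc k) = begin
  c ! * (rise c k * (c + suc k))  ≡⟨ sym (*-assoc (c !) (rise c k) _) ⟩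
  c ! * rise c k * (c + suc k)    ≡⟨ cong (_* (c + suc k)) (factorial-rise c k) ⟩
  (c + k) ! * (c + suc k)         ≡⟨ *-comm ((c + k) !) _ ⟩
  (c + suc k) * (c + k) !         ≡⟨ cong (_* (c + k) !) (+-suc c k) ⟩
  suc (c + k) !                   ≡⟨ cong _! (sym (+-suc c k)) ⟩
  (c + suc k) !                   ∎
  where open ≡-Reasoning

factorial-step : ∀ m y → (m * y) ! * rise (m * y) y ≡ (suc m * y) !
factorial-step m y = trans (factorial-rise (m * y) y) (cong _! (+-comm (m * y) y))

binomial-factorials : ∀ {N K} → K ≤ N → (N C K) * (K ! * (N ∸ K) !) ≡ N !
binomial-factorials {N} {K} K≤N =
  trans (cong (_* (K ! * (N ∸ K) !)) (nCk≡n!/k![n-k]! K≤N))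
        (m/n*n≡m {{K !* (N ∸ K) !≢0}} (k![n∸k]!∣n! K≤N))

binomialSeq : ℕ → ℕ → ℕ → ℕ
binomialSeq δ e m = (m * (δ + e)) C (m * δ)

binomialSeq-factorials : ∀ δ e m →
  binomialSeq δ e m * ((m * δ) ! * (m * e) !) ≡ (m * (δ + e)) !
binomialSeq-factorials δ e m =
  subst (λ t → binomialSeq δ e m * ((m * δ) ! * t !) ≡ (m * (δ + e)) !)
        complement (binomial-factorials (*-monoʳ-≤ m (m≤m+n δ e)))
  where
  complement : m * (δ + e) ∸ m * δ ≡ m * e
  complement = trans (cong (_∸ m * δ) (*-distribˡ-+ m δ e)) (m+n∸m≡n (m * δ) (m * e))

binomialSeq-ratio : ∀ δ e m →
  binomialSeq δ e (suc m) * (rise (m * δ) δ * rise (m * e) e)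
    ≡ binomialSeq δ e m * rise (m * (δ + e)) (δ + e)
binomialSeq-ratio δ e m =
  *-cancelʳ-≡ _ _ (Fδ * Fe) {{(m * δ) !* (m * e) !≢0}} scaled
  where
  open ≡-Reasoning
  a′ a Rδ Re Rd Fδ Fe : ℕ
  a′ = binomialSeq δ e (suc m)
  a  = binomialSeq δ e m
  Rδ = rise (m * δ) δ
  Re = rise (m * e) e
  Rd = rise (m * (δ + e)) (δ + e)
  Fδ = (m * δ) !
  Fe = (m * e) !
  scaled : a′ * (Rδ * Re) * (Fδ * Fe) ≡ a * Rd * (Fδ * Fe)
  scaled = begin
    a′ * (Rδ * Re) * (Fδ * Fe)
      ≡⟨ solve 5 (λ x p q u v → x :* (p :* q) :* (u :* v) := x :* ((u :* p) :* (v :* q)))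
               refl a′ Rδ Re Fδ Fe ⟩
    a′ * ((Fδ * Rδ) * (Fe * Re))
      ≡⟨ cong₂ (λ s t → a′ * (s * t)) (factorial-step m δ) (factorial-step m e) ⟩
    a′ * ((suc m * δ) ! * (suc m * e) !)  ≡⟨ binomialSeq-factorials δ e (suc m) ⟩
    (suc m * (δ + e)) !                   ≡⟨ sym (factorial-step m (δ + e)) ⟩
    (m * (δ + e)) ! * Rd                  ≡⟨ cong (_* Rd) (sym (binomialSeq-factorials δ e m)) ⟩
    a * (Fδ * Fe) * Rd
      ≡⟨ solve 4 (λ x f g r → x :* (f :* g) :* r := x :* r :* (f :* g)) refl a Fδ Fe Rd ⟩
    a * Rd * (Fδ * Fe)                    ∎

ratios-increasing⇒log-convex : (a P D : ℕ → ℕ) → (∀ m → NonZero (P m)) →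
  (∀ m → a (suc m) * P m ≡ a m * D m) →
  ∀ n → D n * P (suc n) ≤ D (suc n) * P n →
  a (suc n) * a (suc n) ≤ a (suc (suc n)) * a n
ratios-increasing⇒log-convex a P D P≢0 ratio n increasing =
  *-cancelʳ-≤ _ _ (p * p′) {{m*n≢0 p p′ {{P≢0 n}} {{P≢0 (suc n)}}}} scaled
  where
  open ≤-Reasoning
  p p′ : ℕ
  p  = P n
  p′ = P (suc n)
  scaled : a (suc n) * a (suc n) * (p * p′) ≤ a (suc (suc n)) * a n * (p * p′)
  scaled = begin
    a (suc n) * a (suc n) * (p * p′)
      ≡⟨ solve 3 (λ b p q → b :* b :* (p :* q) := (b :* p) :* (b :* q)) refl (a (suc n)) p p′ ⟩
    (a (suc n) * p) * (a (suc n) * p′)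
      ≡⟨ cong (_* (a (suc n) * p′)) (ratio n) ⟩
    (a n * D n) * (a (suc n) * p′)
      ≡⟨ solve 4 (λ x r b q → (x :* r) :* (b :* q) := (x :* b) :* (r :* q)) refl (a n) (D n) (a (suc n)) p′ ⟩
    (a n * a (suc n)) * (D n * p′)
      ≤⟨ *-monoʳ-≤ (a n * a (suc n)) increasing ⟩
    (a n * a (suc n)) * (D (suc n) * p)
      ≡⟨ solve 4 (λ x b r q → (x :* b) :* (r :* q) := (b :* r) :* (x :* q)) refl (a n) (a (suc n)) (D (suc n)) p ⟩
    (a (suc n) * D (suc n)) * (a n * p)
      ≡⟨ cong (_* (a n * p)) (sym (ratio (suc n))) ⟩
    (a (suc (suc n)) * p′) * (a n * p)
      ≡⟨ solve 4 (λ c x q p → (c :* q) :* (x :* p) := c :* x :* (p :* q)) refl (a (suc (suc n))) (a n) p′ p ⟩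
    a (suc (suc n)) * a n * (p * p′) ∎

-- One pair of factors: (n d + k)((n+1) y + b) ≤ ((n+1) d + k)(n y + b) iff k y ≤ d b;
-- the two sides differ by exactly d b − k y.
factor-inequality : ∀ n d y k b → k * y ≤ d * b →
  (n * d + k) * (suc n * y + b) ≤ (suc n * d + k) * (n * y + b)
factor-inequality n d y k b ky≤db =
  subst₂ _≤_ (sym left) (sym right) (+-monoʳ-≤ common ky≤db)
  where
  common : ℕ
  common = n * d * (suc n * y) + n * d * b + k * (n * y) + k * b
  left : (n * d + k) * (suc n * y + b) ≡ common + k * y
  left = solve 5 (λ n d y k b → (n :* d :+ k) :* ((con 1 :+ n) :* y :+ b)
    := (n :* d :* ((con 1 :+ n) :* y) :+ n :* d :* b :+ k :* (n :* y) :+ k :* b) :+ k :* y)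
    refl n d y k b
  right : (suc n * d + k) * (n * y + b) ≡ common + d * b
  right = solve 5 (λ n d y k b → ((con 1 :+ n) :* d :+ k) :* (n :* y :+ b)
    := (n :* d :* ((con 1 :+ n) :* y) :+ n :* d :* b :+ k :* (n :* y) :+ k :* b) :+ d :* b)
    refl n d y k b

-- The merge keeps the condition of factor-inequality: if the (q+1)-th y-factor is
-- used after p factors of the other product with p y ≤ (q+1) z, then k = q + p + 1
-- satisfies k y ≤ (y + z)(q + 1).
merge-condition : ∀ y z p q → p * y ≤ suc q * z → suc (q + p) * y ≤ (y + z) * suc q
merge-condition y z p q py≤qz = begin
  suc (q + p) * y       ≡⟨ *-distribʳ-+ y (suc q) p ⟩
  suc q * y + p * y     ≤⟨ +-monoʳ-≤ (suc q * y) py≤qz ⟩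
  suc q * y + suc q * z ≡⟨ sym (*-distribˡ-+ (suc q) y z) ⟩
  suc q * (y + z)       ≡⟨ *-comm (suc q) (y + z) ⟩
  (y + z) * suc q       ∎
  where open ≤-Reasoning

balance⇒lower-bound : ∀ {δ e j l} → 0 < δ → j + l ≡ δ + e → l * δ ≤ suc j * e → δ ≤ j
balance⇒lower-bound {δ} {e} {j} {l} 0<δ sum balanced = ≮⇒≥ λ j<δ →
  <⇒≱ (δe<[1+e]δ) (≤-trans (*-monoˡ-≤ δ (e<l j<δ)) (≤-trans balanced (*-monoˡ-≤ e j<δ)))
  where
  e<l : j < δ → e < l
  e<l j<δ = ≰⇒> λ l≤e → <-irrefl sum (+-mono-<-≤ j<δ l≤e)
  δe<[1+e]δ : δ * e < suc e * δ
  δe<[1+e]δ = subst (_< suc e * δ) (*-comm e δ) (m<n+m (e * δ) 0<δ)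

module Merge (n δ e : ℕ) where

  d : ℕ
  d = δ + e

  -- Partial products after using k factors of D, j of the δ-product and l of the e-product.
  lhs rhs : ℕ → ℕ → ℕ → ℕ
  lhs k j l = rise (n * d) k * rise (suc n * δ) j * rise (suc n * e) l
  rhs k j l = rise (suc n * d) k * rise (n * δ) j * rise (n * e) l

  -- Neither product has run ahead: j/e and l/δ stay within one step of each other.
  Balanced : ℕ → ℕ → Set
  Balanced j l = (l * δ ≤ suc j * e) × (j * e ≤ suc l * δ)

  Reached : ℕ → ℕ → Set
  Reached j l = Balanced j l × lhs (j + l) j l ≤ rhs (j + l) j l

  append : ∀ p u q v w → p * u * (q * v) * w ≡ p * q * w * (u * v)
  append = solve 5 (λ p u q v w → p :* u :* (q :* v) :* w := p :* q :* w :* (u :* v)) refl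

  append′ : ∀ p u q w v → p * u * q * (w * v) ≡ p * q * w * (u * v)
  append′ = solve 5 (λ p u q w v → p :* u :* q :* (w :* v) := p :* q :* w :* (u :* v)) refl

  use-δ : ∀ j l → Reached j l → suc j * e ≤ suc l * δ → Reached (suc j) l
  use-δ j l ((lδ≤ , _) , partial) next =
    (≤-trans lδ≤ (*-monoˡ-≤ e (n≤1+n (suc j))) , next) ,
    subst₂ _≤_
      (sym (append (rise (n * d) (j + l)) (n * d + suc (j + l))
                   (rise (suc n * δ) j) (suc n * δ + suc j) (rise (suc n * e) l)))
      (sym (append (rise (suc n * d) (j + l)) (suc n * d + suc (j + l))
                   (rise (n * δ) j) (n * δ + suc j) (rise (n * e) l)))
      (*-mono-≤ partial
        (factor-inequality n d δ (suc (j + l)) (suc j) (merge-condition δ e l j lδ≤)))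

  use-e : ∀ j l → Reached j l → suc l * δ < suc j * e → Reached j (suc l)
  use-e j l ((_ , je≤) , partial) next =
    (<⇒≤ next , ≤-trans je≤ (*-monoˡ-≤ δ (n≤1+n (suc l)))) ,
    subst (λ k → lhs k j (suc l) ≤ rhs k j (suc l)) (sym (+-suc j l))
      (subst₂ _≤_
        (sym (append′ (rise (n * d) (j + l)) (n * d + suc (j + l))
                      (rise (suc n * δ) j) (rise (suc n * e) l) (suc n * e + suc l)))
        (sym (append′ (rise (suc n * d) (j + l)) (suc n * d + suc (j + l))
                      (rise (n * δ) j) (rise (n * e) l) (n * e + suc l)))
        (*-mono-≤ partial (factor-inequality n d e (suc (j + l)) (suc l) condition)))
    where
    condition : suc (j + l) * e ≤ d * suc l
    condition = subst₂ _≤_ (cong (λ s → suc s * e) (+-comm l j)) (cong (_* suc l) (+-comm e δ))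
                  (merge-condition e δ j l je≤)

  merge : ∀ s j l → Reached j l → Σ ℕ λ j′ → Σ ℕ λ l′ → (j′ + l′ ≡ s + (j + l)) × Reached j′ l′
  merge zero j l r = j , l , refl , r
  merge (suc s) j l r with suc j * e ≤? suc l * δ
  ... | yes δ-first =
    let (j′ , l′ , steps , r′) = merge s (suc j) l (use-δ j l r δ-first)
    in j′ , l′ , trans steps (+-suc s (j + l)) , r′
  ... | no e-first =
    let (j′ , l′ , steps , r′) = merge s j (suc l) (use-e j l r (≰⇒> e-first))
    in j′ , l′ , trans steps (trans (cong (s +_) (+-suc j l)) (+-suc s (j + l))) , r′

  -- After d steps from the start the merge has used all δ- and all e-factors.
  ratio-monotone : 0 < δ → 0 < e →
    rise (n * d) d * rise (suc n * δ) δ * rise (suc n * e) e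
      ≤ rise (suc n * d) d * rise (n * δ) δ * rise (n * e) e
  ratio-monotone 0<δ 0<e with merge d 0 0 ((z≤n , z≤n) , ≤-refl)
  ... | j , l , steps , ((lδ≤ , je≤) , partial) =
    subst (λ k → lhs k δ e ≤ rhs k δ e) sum
      (subst₂ (λ j′ l′ → lhs (j + l) j′ l′ ≤ rhs (j + l) j′ l′) j≡δ l≡e partial)
    where
    sum : j + l ≡ δ + e
    sum = trans steps (+-identityʳ d)
    δ≤j : δ ≤ j
    δ≤j = balance⇒lower-bound 0<δ sum lδ≤
    e≤l : e ≤ l
    e≤l = balance⇒lower-bound 0<e (trans (+-comm l j) (trans sum (+-comm δ e))) je≤
    j≡δ : j ≡ δ
    j≡δ = ≤-antisym (+-cancelʳ-≤ e j δ (subst (j + e ≤_) sum (+-monoʳ-≤ j e≤l))) δ≤j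
    l≡e : l ≡ e
    l≡e = +-cancelˡ-≡ δ l e (trans (cong (_+ l) (sym j≡δ)) sum)

binomialSeq-log-convex : ∀ δ e → 0 < δ → 0 < e → ∀ n →
  binomialSeq δ e (suc n) * binomialSeq δ e (suc n)
    ≤ binomialSeq δ e (suc (suc n)) * binomialSeq δ e n
binomialSeq-log-convex δ e 0<δ 0<e n =
  ratios-increasing⇒log-convex (binomialSeq δ e) P D
    (λ m → m*n≢0 _ _ {{rise-nonZero (m * δ) δ}} {{rise-nonZero (m * e) e}})
    (binomialSeq-ratio δ e) n
    (subst₂ _≤_ (*-assoc (D n) _ _) (*-assoc (D (suc n)) _ _)
                (Merge.ratio-monotone n δ e 0<δ 0<e))
  where
  P D : ℕ → ℕ
  P m = rise (m * δ) δ * rise (m * e) e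
  D m = rise (m * (δ + e)) (δ + e)

proposition4p1 : (d δ : ℕ) → 0 < δ → δ < d → (i : ℕ) → 1 ≤ i →
    ((i * d) C (i * δ)) * ((i * d) C (i * δ))
      ≤ (((i + 1) * d) C ((i + 1) * δ)) * (((i ∸ 1) * d) C ((i ∸ 1) * δ))
proposition4p1 d δ 0<δ δ<d (suc n) _
  with m≤n⇒∃[o]m+o≡n (<⇒≤ δ<d)
... | e , refl rewrite +-comm n 1 =
  binomialSeq-log-convex δ e 0<δ (subst (0 <_) (m+n∸m≡n δ e) (m<n⇒0<n∸m δ<d)) n
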